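{- Let $S$ be a set, let $f\colon 2^S\to 2^S$ be monotonic with respect to $\subseteq$, and let $X\subseteq S$. Then $X$ is supported for $f$ if and only if $X\subseteq f(X)$.
   Context: A support ordering for $f$ is a pair $(X,\prec)$ with $X\subseteq S$ and $\prec\subseteq X\times X$ a binary relation such that for every $x\in X$, $x\in f(\{x'\in X\mid x'\prec x\})$. A set $X\subseteq S$ is supported for $f$ if there exists a binary relation $\prec\subseteq X\times X$ such that $(X,\prec)$ is a support ordering for $f$. -}

module Defs where

open import Level using (Level; _⊔_; suc)
open import Data.Product using (Σ; _×_)
open import Relation.Unary using (Pred; _⊆_; _∈_)
open import Relation.Binary using (Rel)

Monotonic : ∀ {a ℓ} {S : Set a} → (Pred S ℓ → Pred S ℓ) → Set (a ⊔ suc ℓ)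
Monotonic {S = S} f = ∀ {A B : Pred S _} → A ⊆ B → f A ⊆ f B

predecessors : ∀ {a ℓ} {S : Set a} → Pred S ℓ → Rel S ℓ → S → Pred S ℓ
predecessors X _≺_ x = λ x' → x' ∈ X × x' ≺ x

IsSupportOrdering : ∀ {a ℓ} {S : Set a} → (Pred S ℓ → Pred S ℓ) → Pred S ℓ → Rel S ℓ → Set (a ⊔ ℓ)
IsSupportOrdering f X _≺_ =
  (∀ {x y} → x ≺ y → x ∈ X × y ∈ X) ×
  (∀ {x} → x ∈ X → x ∈ f (predecessors X _≺_ x))

Supported : ∀ {a ℓ} {S : Set a} → (Pred S ℓ → Pred S ℓ) → Pred S ℓ → Set (a ⊔ suc ℓ)
Supported {S = S} f X = Σ (Rel S _) λ _≺_ → IsSupportOrdering f X _≺_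

{-# OPTIONS --safe #-}
module Submission where

open import Defs
open import Function.Bundles using (_⇔_; mk⇔)
open import Relation.Unary using (Pred; _⊆_)
open import Data.Product using (_,_; proj₁; _×_)
open import Relation.Binary using (Rel)

module _ {a ℓ} {S : Set a} {f : Pred S ℓ → Pred S ℓ} where

  supported⇒⊆ : Monotonic f → ∀ {X} → Supported f X → X ⊆ f X
  supported⇒⊆ mono (_ , _ , support) x∈X = mono proj₁ (support x∈X)

  complete : Pred S ℓ → Rel S ℓ
  complete X x y = X x × X y

  -- Under the complete relation on X, the predecessors of any x ∈ X are all of X.
  ⊆⇒complete-isSupportOrdering : Monotonic f → ∀ {X} → X ⊆ f X →
                                 IsSupportOrdering f X (complete X)
  ⊆⇒complete-isSupportOrdering mono X⊆fX =
    (λ x≺y → x≺y) , λ x∈X → mono (λ y∈X → y∈X , y∈X , x∈X) (X⊆fX x∈X)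

  ⊆⇒supported : Monotonic f → ∀ {X} → X ⊆ f X → Supported f X
  ⊆⇒supported mono {X} X⊆fX =
    complete X , ⊆⇒complete-isSupportOrdering mono X⊆fX

theorem2 : ∀ {a ℓ} (S : Set a) (f : Pred S ℓ → Pred S ℓ) → Monotonic f →
             (X : Pred S ℓ) → Supported f X ⇔ (X ⊆ f X)
theorem2 S f mono X = mk⇔ (supported⇒⊆ mono) (⊆⇒supported mono)
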